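{- Let $A$ be the adjacency matrix of a graph of even order $n$ and write $\chi_{J-2A}(x)=\sum_{i=0}^n a_ix^{n-i}$. Then $2^r$ divides $a_r$ for all $r\in\{0,\dots,n\}$.
   Context: Graphs are simple. $\chi_M(x)=\det(xI-M)$; $J$ is the all-ones matrix of order $n$. -}

module Defs where

open import Data.Nat using (ℕ; zero; suc)
open import Data.Bool using (Bool; true; false; if_then_else_)
open import Data.Integer using (ℤ; 0ℤ; 1ℤ; -_) renaming (_+_ to _+ℤ_; _*_ to _*ℤ_; _-_ to _-ℤ_)
open import Data.Fin using (Fin; zero; suc; punchIn; _≟_)
open import Data.List using (List; []; _∷_; map)
open import Relation.Nullary using (¬_; does)
open import Relation.Binary.PropositionalEquality using (_≡_)

-- Univariate polynomials over ℤ as coefficient lists, lowest degree first: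
-- a₀ ∷ a₁ ∷ … represents a₀ + a₁ x + …  (trailing zeros allowed).

Poly : Set
Poly = List ℤ

infixl 6 _+P_
infixl 7 _*P_

_+P_ : Poly → Poly → Poly
[]      +P q       = q
p       +P []      = p
(a ∷ p) +P (b ∷ q) = (a +ℤ b) ∷ (p +P q)

scaleP : ℤ → Poly → Poly
scaleP a = map (a *ℤ_)

negP : Poly → Poly
negP = map -_

_*P_ : Poly → Poly → Poly
[]      *P q = []
(a ∷ p) *P q = scaleP a q +P (0ℤ ∷ (p *P q))

constP : ℤ → Poly
constP c = c ∷ []

X : Poly
X = 0ℤ ∷ 1ℤ ∷ []

coeff : Poly → ℕ → ℤ
coeff []      _       = 0ℤ
coeff (a ∷ p) zero    = a
coeff (a ∷ p) (suc k) = coeff p k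

altSum : ∀ {n} → (Fin n → Poly) → Poly
altSum {zero}  f = []
altSum {suc n} f = f zero +P negP (altSum (λ j → f (suc j)))

detP : ∀ n → (Fin n → Fin n → Poly) → Poly
detP zero    M = constP 1ℤ
detP (suc n) M = altSum (λ j → M zero j *P detP n (λ i k → M (suc i) (punchIn j k)))

Matrix : ℕ → Set
Matrix n = Fin n → Fin n → ℤ

charPoly : ∀ n → Matrix n → Poly
charPoly n M = detP n (λ i j →
  if does (i ≟ j) then X +P constP (- M i j) else constP (- M i j))

J : ∀ n → Matrix n
J n i j = 1ℤ

record SimpleGraph (n : ℕ) : Set where
  field
    Adj   : Fin n → Fin n → Bool
    sym   : ∀ i j → Adj i j ≡ Adj j i
    loopless : ∀ i → Adj i i ≡ false

adjMatrix : ∀ {n} → SimpleGraph n → Matrix n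
adjMatrix G i j = if SimpleGraph.Adj G i j then 1ℤ else 0ℤ

J-2A : ∀ {n} → SimpleGraph n → Matrix n
J-2A {n} G i j = J n i j -ℤ (Data.Integer.+ 2 *ℤ adjMatrix G i j)

module Submission where

-- Let 𝔪 = (2, x) ⊂ ℤ[x]; the claim is that χ_{J−2A} lies in 𝔪^n. Put E = xI + 2A, so that
-- χ_{J−2A} = det (E − J): the entries of E lie in 𝔪, E is symmetric and its diagonal is constant.
-- Subtracting the first row of E − J from the others and then the first column from the others
-- leaves a first row and column in 𝔪 (apart from the corner) around the matrix
-- C_ij = E_ij − E_0j − E_i0 + E_00, which is symmetric of odd order n − 1, has entries in 𝔪 and
-- diagonal 2 (E_00 − E_i0) ∈ 𝔪². Such a C has det C ∈ 𝔪^n: expanding along its first row and then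
-- the first column of each minor, the off-diagonal products pair up into twice an element of 𝔪^(n−1),
-- and the diagonal ones contain a principal minor of the same kind, handled by induction.

open import Defs
open import Algebra.Bundles using (CommutativeRing)
open import Data.Nat using (ℕ; zero; suc)
import Data.Nat as ℕ
open import Data.Product using (_,_)
open import Level using (_⊔_; 0ℓ) renaming (suc to lsuc)

module Polynomial where

  open import Data.Integer using (0ℤ; 1ℤ; -_; _+_; _*_)
  import Data.Integer.Properties as ℤ
  open import Data.List using ([]; _∷_)
  open import Relation.Binary.Bundles using (Setoid)
  open import Relation.Binary.PropositionalEquality using (_≡_; refl; sym; trans; cong; cong₂)

  -- Coefficient lists may end in zeros, so polynomials form a ring only up to coefficientwise equality.
  infix 4 _≈P_
  record _≈P_ (p q : Poly) : Set where
    constructor coeffwise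
    field coeff-≡ : ∀ k → coeff p k ≡ coeff q k
  open _≈P_ public

  coeff-+P : ∀ p q k → coeff (p +P q) k ≡ coeff p k + coeff q k
  coeff-+P []      q       k       = sym (ℤ.+-identityˡ _)
  coeff-+P (a ∷ p) []      k       = sym (ℤ.+-identityʳ _)
  coeff-+P (a ∷ p) (b ∷ q) zero    = refl
  coeff-+P (a ∷ p) (b ∷ q) (suc k) = coeff-+P p q k

  coeff-negP : ∀ p k → coeff (negP p) k ≡ - coeff p k
  coeff-negP []      k       = refl
  coeff-negP (a ∷ p) zero    = refl
  coeff-negP (a ∷ p) (suc k) = coeff-negP p k

  coeff-scaleP : ∀ c p k → coeff (scaleP c p) k ≡ c * coeff p k
  coeff-scaleP c []      k       = sym (ℤ.*-zeroʳ c)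
  coeff-scaleP c (a ∷ p) zero    = refl
  coeff-scaleP c (a ∷ p) (suc k) = coeff-scaleP c p k

  ≈P-setoid : Setoid _ _
  ≈P-setoid = record
    { Carrier       = Poly
    ; _≈_           = _≈P_
    ; isEquivalence = record
      { refl  = coeffwise λ _ → refl
      ; sym   = λ p≈q → coeffwise λ k → sym (coeff-≡ p≈q k)
      ; trans = λ p≈q q≈r → coeffwise λ k → trans (coeff-≡ p≈q k) (coeff-≡ q≈r k)
      }
    }

  open Setoid ≈P-setoid public using () renaming (refl to ≈P-refl; sym to ≈P-sym; trans to ≈P-trans)
  open import Relation.Binary.Reasoning.Setoid ≈P-setoid

  ∷-cong : ∀ {a b p q} → a ≡ b → p ≈P q → a ∷ p ≈P b ∷ q
  ∷-cong a≡b p≈q = coeffwise λ where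
    zero    → a≡b
    (suc k) → coeff-≡ p≈q k

  0∷[]≈[] : 0ℤ ∷ [] ≈P []
  0∷[]≈[] = coeffwise λ where
    zero    → refl
    (suc k) → refl

  +P-cong : ∀ {p p′ q q′} → p ≈P p′ → q ≈P q′ → p +P q ≈P p′ +P q′
  +P-cong {p} {p′} {q} {q′} p≈ q≈ = coeffwise λ k → trans (coeff-+P p q k)
    (trans (cong₂ _+_ (coeff-≡ p≈ k) (coeff-≡ q≈ k)) (sym (coeff-+P p′ q′ k)))

  +P-congˡ : ∀ p {q q′} → q ≈P q′ → p +P q ≈P p +P q′
  +P-congˡ p = +P-cong {p} ≈P-refl

  negP-cong : ∀ {p q} → p ≈P q → negP p ≈P negP q
  negP-cong {p} {q} p≈q = coeffwise λ k →
    trans (coeff-negP p k) (trans (cong -_ (coeff-≡ p≈q k)) (sym (coeff-negP q k)))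

  scaleP-congʳ : ∀ c {p q} → p ≈P q → scaleP c p ≈P scaleP c q
  scaleP-congʳ c {p} {q} p≈q = coeffwise λ k →
    trans (coeff-scaleP c p k) (trans (cong (c *_) (coeff-≡ p≈q k)) (sym (coeff-scaleP c q k)))

  +P-assoc : ∀ p q r → (p +P q) +P r ≈P p +P (q +P r)
  +P-assoc p q r = coeffwise λ k →
    trans (coeff-+P (p +P q) r k) (trans (cong (_+ coeff r k) (coeff-+P p q k))
    (trans (ℤ.+-assoc (coeff p k) (coeff q k) (coeff r k))
    (trans (cong (coeff p k +_) (sym (coeff-+P q r k))) (sym (coeff-+P p (q +P r) k)))))

  +P-comm : ∀ p q → p +P q ≈P q +P p
  +P-comm p q = coeffwise λ k →
    trans (coeff-+P p q k) (trans (ℤ.+-comm (coeff p k) (coeff q k)) (sym (coeff-+P q p k)))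

  +P-identityʳ : ∀ p → p +P [] ≈P p
  +P-identityʳ p = coeffwise λ k → trans (coeff-+P p [] k) (ℤ.+-identityʳ (coeff p k))

  +P-inverseˡ : ∀ p → negP p +P p ≈P []
  +P-inverseˡ p = coeffwise λ k → trans (coeff-+P (negP p) p k)
    (trans (cong (_+ coeff p k) (coeff-negP p k)) (ℤ.+-inverseˡ (coeff p k)))

  scaleP-distribˡ : ∀ a p q → scaleP a (p +P q) ≈P scaleP a p +P scaleP a q
  scaleP-distribˡ a p q = coeffwise λ k →
    trans (coeff-scaleP a (p +P q) k) (trans (cong (a *_) (coeff-+P p q k))
    (trans (ℤ.*-distribˡ-+ a (coeff p k) (coeff q k))
    (sym (trans (coeff-+P (scaleP a p) (scaleP a q) k) (cong₂ _+_ (coeff-scaleP a p k) (coeff-scaleP a q k))))))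

  scaleP-distribʳ : ∀ a b p → scaleP (a + b) p ≈P scaleP a p +P scaleP b p
  scaleP-distribʳ a b p = coeffwise λ k →
    trans (coeff-scaleP (a + b) p k) (trans (ℤ.*-distribʳ-+ (coeff p k) a b)
    (sym (trans (coeff-+P (scaleP a p) (scaleP b p) k) (cong₂ _+_ (coeff-scaleP a p k) (coeff-scaleP b p k)))))

  scaleP-assoc : ∀ a b p → scaleP (a * b) p ≈P scaleP a (scaleP b p)
  scaleP-assoc a b p = coeffwise λ k →
    trans (coeff-scaleP (a * b) p k) (trans (ℤ.*-assoc a b (coeff p k))
    (sym (trans (coeff-scaleP a (scaleP b p) k) (cong (a *_) (coeff-scaleP b p k)))))

  scaleP-identity : ∀ p → scaleP 1ℤ p ≈P p
  scaleP-identity p = coeffwise λ k → trans (coeff-scaleP 1ℤ p k) (ℤ.*-identityˡ (coeff p k))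

  scaleP-zero : ∀ p → scaleP 0ℤ p ≈P []
  scaleP-zero p = coeffwise λ k → trans (coeff-scaleP 0ℤ p k) (ℤ.*-zeroˡ (coeff p k))

  open import Algebra.Consequences.Setoid ≈P-setoid
    using (comm∧assoc⇒middleFour; comm∧idˡ⇒idʳ; comm∧invˡ⇒inv; comm∧distrʳ⇒distr)

  +P-middleFour : ∀ w x y z → (w +P x) +P (y +P z) ≈P (w +P y) +P (x +P z)
  +P-middleFour = comm∧assoc⇒middleFour +P-cong +P-comm +P-assoc

  *P-congˡ : ∀ p {q q′} → q ≈P q′ → p *P q ≈P p *P q′
  *P-congˡ []      q≈q′ = ≈P-refl
  *P-congˡ (a ∷ p) q≈q′ = +P-cong (scaleP-congʳ a q≈q′) (∷-cong refl (*P-congˡ p q≈q′))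

  *P-zeroʳ : ∀ p → p *P [] ≈P []
  *P-zeroʳ []      = ≈P-refl
  *P-zeroʳ (a ∷ p) = ≈P-trans (∷-cong refl (*P-zeroʳ p)) 0∷[]≈[]

  *P-∷ʳ : ∀ p b q → p *P (b ∷ q) ≈P scaleP b p +P (0ℤ ∷ p *P q)
  *P-∷ʳ []      b q = ≈P-sym 0∷[]≈[]
  *P-∷ʳ (a ∷ p) b q = ∷-cong (cong (_+ 0ℤ) (ℤ.*-comm a b)) (begin
    scaleP a q +P p *P (b ∷ q)                   ≈⟨ +P-congˡ (scaleP a q) (*P-∷ʳ p b q) ⟩
    scaleP a q +P (scaleP b p +P (0ℤ ∷ p *P q)) ≈⟨ +P-assoc (scaleP a q) (scaleP b p) _ ⟨
    (scaleP a q +P scaleP b p) +P (0ℤ ∷ p *P q) ≈⟨ +P-cong (+P-comm (scaleP a q) (scaleP b p)) ≈P-refl ⟩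
    (scaleP b p +P scaleP a q) +P (0ℤ ∷ p *P q) ≈⟨ +P-assoc (scaleP b p) (scaleP a q) _ ⟩
    scaleP b p +P (scaleP a q +P (0ℤ ∷ p *P q)) ∎)

  *P-comm : ∀ p q → p *P q ≈P q *P p
  *P-comm []      q = ≈P-sym (*P-zeroʳ q)
  *P-comm (a ∷ p) q = begin
    scaleP a q +P (0ℤ ∷ p *P q) ≈⟨ +P-congˡ (scaleP a q) (∷-cong refl (*P-comm p q)) ⟩
    scaleP a q +P (0ℤ ∷ q *P p) ≈⟨ *P-∷ʳ q a p ⟨
    q *P (a ∷ p)                ∎

  *P-cong : ∀ {p p′ q q′} → p ≈P p′ → q ≈P q′ → p *P q ≈P p′ *P q′
  *P-cong {p} {p′} {q} {q′} p≈p′ q≈q′ = begin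
    p *P q   ≈⟨ *P-congˡ p q≈q′ ⟩
    p *P q′  ≈⟨ *P-comm p q′ ⟩
    q′ *P p  ≈⟨ *P-congˡ q′ p≈p′ ⟩
    q′ *P p′ ≈⟨ *P-comm q′ p′ ⟩
    p′ *P q′ ∎

  *P-distribʳ : ∀ q p p′ → (p +P p′) *P q ≈P p *P q +P p′ *P q
  *P-distribʳ q []      p′       = ≈P-refl
  *P-distribʳ q (a ∷ p) []       = ≈P-sym (+P-identityʳ _)
  *P-distribʳ q (a ∷ p) (a′ ∷ p′) = begin
    scaleP (a + a′) q +P (0ℤ ∷ (p +P p′) *P q)
      ≈⟨ +P-cong (scaleP-distribʳ a a′ q) (∷-cong refl (*P-distribʳ q p p′)) ⟩
    (scaleP a q +P scaleP a′ q) +P ((0ℤ ∷ p *P q) +P (0ℤ ∷ p′ *P q))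
      ≈⟨ +P-middleFour (scaleP a q) (scaleP a′ q) _ _ ⟩
    (scaleP a q +P (0ℤ ∷ p *P q)) +P (scaleP a′ q +P (0ℤ ∷ p′ *P q)) ∎

  scaleP-*P : ∀ a q r → scaleP a q *P r ≈P scaleP a (q *P r)
  scaleP-*P a []      r = ≈P-refl
  scaleP-*P a (b ∷ q) r = begin
    scaleP (a * b) r +P (0ℤ ∷ scaleP a q *P r)
      ≈⟨ +P-cong (scaleP-assoc a b r) (∷-cong (sym (ℤ.*-zeroʳ a)) (scaleP-*P a q r)) ⟩
    scaleP a (scaleP b r) +P scaleP a (0ℤ ∷ q *P r) ≈⟨ scaleP-distribˡ a (scaleP b r) _ ⟨
    scaleP a (scaleP b r +P (0ℤ ∷ q *P r))         ∎

  0∷-*P : ∀ p q → (0ℤ ∷ p) *P q ≈P 0ℤ ∷ p *P q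
  0∷-*P p q = +P-cong (scaleP-zero q) ≈P-refl

  *P-assoc : ∀ p q r → (p *P q) *P r ≈P p *P (q *P r)
  *P-assoc []      q r = ≈P-refl
  *P-assoc (a ∷ p) q r = begin
    (scaleP a q +P (0ℤ ∷ p *P q)) *P r          ≈⟨ *P-distribʳ r (scaleP a q) _ ⟩
    scaleP a q *P r +P (0ℤ ∷ p *P q) *P r       ≈⟨ +P-cong (scaleP-*P a q r) (0∷-*P (p *P q) r) ⟩
    scaleP a (q *P r) +P (0ℤ ∷ (p *P q) *P r)   ≈⟨ +P-congˡ (scaleP a (q *P r)) (∷-cong refl (*P-assoc p q r)) ⟩
    scaleP a (q *P r) +P (0ℤ ∷ p *P (q *P r))   ∎

  *P-identityˡ : ∀ p → constP 1ℤ *P p ≈P p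
  *P-identityˡ p = ≈P-trans (+P-cong (scaleP-identity p) 0∷[]≈[]) (+P-identityʳ p)

  ℤ[X] : CommutativeRing _ _
  ℤ[X] = record
    { Carrier = Poly ; _≈_ = _≈P_ ; _+_ = _+P_ ; _*_ = _*P_ ; -_ = negP ; 0# = [] ; 1# = constP 1ℤ
    ; isCommutativeRing = record
      { isRing = record
        { +-isAbelianGroup = record
          { isGroup = record
            { isMonoid = record
              { isSemigroup = record
                { isMagma = record { isEquivalence = Setoid.isEquivalence ≈P-setoid ; ∙-cong = +P-cong }
                ; assoc = +P-assoc }
              ; identity = (λ _ → ≈P-refl) , +P-identityʳ }
            ; inverse = comm∧invˡ⇒inv +P-comm +P-inverseˡ
            ; ⁻¹-cong = negP-cong }
          ; comm = +P-comm }
        ; *-cong = *P-cong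
        ; *-assoc = *P-assoc
        ; *-identity = *P-identityˡ , comm∧idˡ⇒idʳ *P-comm *P-identityˡ
        ; distrib = comm∧distrʳ⇒distr +P-cong *P-comm *P-distribʳ }
      ; *-comm = *P-comm } }

module Determinant {c ℓ} (R : CommutativeRing c ℓ) where

  open import Data.Fin using (Fin; zero; suc; punchIn)
  open import Data.Maybe using (nothing)
  open import Relation.Binary.PropositionalEquality using (_≡_; cong-app) renaming (refl to ≡-refl)
  open CommutativeRing R hiding (zero)
  open import Algebra.Properties.Ring ring using (-‿distribʳ-*)
  open import Algebra.Properties.AbelianGroup +-abelianGroup using (⁻¹-∙-comm; ⁻¹-involutive; ε⁻¹≈ε)
  open import Algebra.Properties.Semiring.Sum semiring using (sum; sum-cong-≋; sum-replicate-zero; *-distribˡ-sum)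
  open import Data.Vec.Functional using (_∷_; updateAt)
  open import Data.Vec.Functional.Properties using (updateAt-updates)
  open import Algebra.Properties.CommutativeSemigroup *-commutativeSemigroup public using (x∙yz≈y∙xz)
  open import Relation.Binary.Reasoning.Setoid setoid
  import Tactic.RingSolver.Core.AlmostCommutativeRing as ACR
  open import Tactic.RingSolver.NonReflective (ACR.fromCommutativeRing R (λ _ → nothing))
    using (solve; _⊜_; _⊕_; _⊗_)

  Mat : ℕ → Set c
  Mat n = Fin n → Fin n → Carrier

  transpose : ∀ {n} → Mat n → Mat n
  transpose M i j = M j i

  alt : ∀ {n} → (Fin n → Carrier) → Carrier
  alt {zero}  f = 0#
  alt {suc n} f = f zero + - alt (λ j → f (suc j))

  minor : ∀ {n} → Fin (suc n) → Mat (suc n) → Mat n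
  minor j M i k = M (suc i) (punchIn j k)

  minorᵗ : ∀ {n} → Fin (suc n) → Mat (suc n) → Mat n
  minorᵗ i M = transpose (minor i (transpose M))

  det : ∀ n → Mat n → Carrier
  det zero    M = 1#
  det (suc n) M = alt (λ j → M zero j * det n (minor j M))

  -‿distrib-+ : ∀ x y → - (x + y) ≈ - x + - y
  -‿distrib-+ x y = sym (⁻¹-∙-comm x y)

  -‿distrib-+- : ∀ x y → - (x + - y) ≈ - x + y
  -‿distrib-+- x y = trans (-‿distrib-+ x (- y)) (+-congˡ (⁻¹-involutive y))

  alt-cong : ∀ {n} {f g : Fin n → Carrier} → (∀ j → f j ≈ g j) → alt f ≈ alt g
  alt-cong {zero}  f≈g = refl
  alt-cong {suc n} f≈g = +-cong (f≈g zero) (-‿cong (alt-cong (λ j → f≈g (suc j))))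

  alt-zero : ∀ {n} (f : Fin n → Carrier) → (∀ j → f j ≈ 0#) → alt f ≈ 0#
  alt-zero {zero}  f f≈0 = refl
  alt-zero {suc n} f f≈0 = begin
    f zero + - alt (λ j → f (suc j)) ≈⟨ +-cong (f≈0 zero) (-‿cong (alt-zero _ (λ j → f≈0 (suc j)))) ⟩
    0# + - 0#                        ≈⟨ -‿inverseʳ 0# ⟩
    0#                               ∎

  alt-suc-suc : ∀ {n} (f : Fin (suc (suc n)) → Carrier) →
    alt f ≈ (f zero + - f (suc zero)) + alt (λ j → f (suc (suc j)))
  alt-suc-suc f = begin
    f zero + - (f (suc zero) + - A)  ≈⟨ +-congˡ (-‿distrib-+- (f (suc zero)) A) ⟩
    f zero + (- f (suc zero) + A)    ≈⟨ +-assoc _ _ _ ⟨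
    (f zero + - f (suc zero)) + A    ∎
    where A = alt (λ j → f (suc (suc j)))

  alt-distrib-+ : ∀ {n} (f g : Fin n → Carrier) → alt (λ j → f j + g j) ≈ alt f + alt g
  alt-distrib-+ {zero}  f g = sym (+-identityˡ 0#)
  alt-distrib-+ {suc n} f g = begin
    (f zero + g zero) + - alt (λ j → f (suc j) + g (suc j))
      ≈⟨ +-congˡ (-‿cong (alt-distrib-+ (λ j → f (suc j)) (λ j → g (suc j)))) ⟩
    (f zero + g zero) + - (A + B)   ≈⟨ +-congˡ (-‿distrib-+ A B) ⟩
    (f zero + g zero) + (- A + - B)
      ≈⟨ solve 4 (λ a b c d → ((a ⊕ b) ⊕ (c ⊕ d)) ⊜ ((a ⊕ c) ⊕ (b ⊕ d))) refl (f zero) (g zero) (- A) (- B) ⟩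
    (f zero + - A) + (g zero + - B) ∎
    where
    A = alt (λ j → f (suc j))
    B = alt (λ j → g (suc j))

  alt-neg : ∀ {n} (f : Fin n → Carrier) → alt (λ j → - f j) ≈ - alt f
  alt-neg {zero}  f = sym ε⁻¹≈ε
  alt-neg {suc n} f = begin
    - f zero + - alt (λ j → - f (suc j)) ≈⟨ +-congˡ (-‿cong (alt-neg (λ j → f (suc j)))) ⟩
    - f zero + - - alt (λ j → f (suc j)) ≈⟨ -‿distrib-+ _ _ ⟨
    - (f zero + - alt (λ j → f (suc j))) ∎

  *-distribˡ-alt : ∀ {n} x (f : Fin n → Carrier) → x * alt f ≈ alt (λ j → x * f j)
  *-distribˡ-alt {zero}  x f = zeroʳ x
  *-distribˡ-alt {suc n} x f = begin
    x * (f zero + - A)         ≈⟨ distribˡ x _ _ ⟩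
    x * f zero + x * - A       ≈⟨ +-congˡ (-‿distribʳ-* x A) ⟨
    x * f zero + - (x * A)     ≈⟨ +-congˡ (-‿cong (*-distribˡ-alt x (λ j → f (suc j)))) ⟩
    x * f zero + - alt (λ j → x * f (suc j)) ∎
    where A = alt (λ j → f (suc j))

  alt-comm : ∀ {m n} (f : Fin m → Fin n → Carrier) →
    alt (λ j → alt (λ i → f i j)) ≈ alt (λ i → alt (λ j → f i j))
  alt-comm {m} {zero}  f = sym (alt-zero {m} (λ i → 0#) (λ i → refl))
  alt-comm {m} {suc n} f = begin
    alt (λ i → f i zero) + - alt (λ j → alt (λ i → f i (suc j)))
      ≈⟨ +-congˡ (-‿cong (alt-comm (λ i j → f i (suc j)))) ⟩
    alt (λ i → f i zero) + - alt (λ i → alt (λ j → f i (suc j)))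
      ≈⟨ +-congˡ (alt-neg (λ i → alt (λ j → f i (suc j)))) ⟨
    alt (λ i → f i zero) + alt (λ i → - alt (λ j → f i (suc j)))
      ≈⟨ alt-distrib-+ (λ i → f i zero) (λ i → - alt (λ j → f i (suc j))) ⟨
    alt (λ i → f i zero + - alt (λ j → f i (suc j))) ∎

  alt-sum-comm : ∀ {m n} (f : Fin m → Fin n → Carrier) →
    alt (λ j → sum (λ i → f i j)) ≈ sum (λ i → alt (λ j → f i j))
  alt-sum-comm {zero}  {n} f = alt-zero {n} (λ j → 0#) (λ j → refl)
  alt-sum-comm {suc m} {n} f =
    trans (alt-distrib-+ (λ j → f zero j) (λ j → sum (λ i → f (suc i) j)))
          (+-congˡ (alt-sum-comm (λ i j → f (suc i) j)))

  det-cong : ∀ n {M N : Mat n} → (∀ i j → M i j ≈ N i j) → det n M ≈ det n N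
  det-cong zero    M≈N = refl
  det-cong (suc n) M≈N = alt-cong λ j →
    *-cong (M≈N zero j) (det-cong n (λ a b → M≈N (suc a) (punchIn j b)))

  det-expandCol0 : ∀ n (M : Mat (suc n)) → det (suc n) M ≈ alt (λ i → M i zero * det n (minorᵗ i M))
  det-expandCol0 zero    M = refl
  det-expandCol0 (suc n) M = +-congˡ (-‿cong (begin
    alt (λ j → M zero (suc j) * det (suc n) (minor (suc j) M))
      ≈⟨ alt-cong (λ j → *-congˡ {M zero (suc j)} (det-expandCol0 n (minor (suc j) M))) ⟩
    alt (λ j → M zero (suc j) * alt (λ i → M (suc i) zero * D i j))
      ≈⟨ alt-cong (λ j → *-distribˡ-alt (M zero (suc j)) (λ i → M (suc i) zero * D i j)) ⟩
    alt (λ j → alt (λ i → M zero (suc j) * (M (suc i) zero * D i j)))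
      ≈⟨ alt-comm (λ i j → M zero (suc j) * (M (suc i) zero * D i j)) ⟩
    alt (λ i → alt (λ j → M zero (suc j) * (M (suc i) zero * D i j)))
      ≈⟨ alt-cong (λ i → alt-cong (λ j → x∙yz≈y∙xz (M zero (suc j)) (M (suc i) zero) (D i j))) ⟩
    alt (λ i → alt (λ j → M (suc i) zero * (M zero (suc j) * D i j)))
      ≈⟨ alt-cong (λ i → *-distribˡ-alt (M (suc i) zero) (λ j → M zero (suc j) * D i j)) ⟨
    alt (λ i → M (suc i) zero * det (suc n) (minorᵗ (suc i) M)) ∎))
    where
    D : Fin (suc n) → Fin (suc n) → Carrier
    D i j = det n (λ a b → M (suc (punchIn i a)) (suc (punchIn j b)))

  det-transpose : ∀ n (M : Mat n) → det n (transpose M) ≈ det n M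
  det-transpose zero    M = refl
  det-transpose (suc n) M = begin
    alt (λ j → M j zero * det n (minor j (transpose M)))
      ≈⟨ alt-cong (λ j → *-congˡ {M j zero} (det-transpose n (minorᵗ j M))) ⟩
    alt (λ j → M j zero * det n (minorᵗ j M))
      ≈⟨ det-expandCol0 n M ⟨
    det (suc n) M ∎

  det-equalCols01 : ∀ n (M : Mat (suc (suc n))) → (∀ i → M i zero ≈ M i (suc zero)) →
    det (suc (suc n)) M ≈ 0#
  minor-equalCols01 : ∀ n (M : Mat (suc (suc n))) → (∀ i → M i zero ≈ M i (suc zero)) →
    (k : Fin n) → det (suc n) (minor (suc (suc k)) M) ≈ 0#

  det-equalCols01 n M cols = begin
    det (suc (suc n)) M          ≈⟨ alt-suc-suc (λ j → M zero j * det (suc n) (minor j M)) ⟩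
    (t₀ + - t₁) + rest           ≈⟨ +-cong (+-congʳ (*-cong (cols zero) (det-cong (suc n) minors))) rest≈0 ⟩
    (t₁ + - t₁) + 0#             ≈⟨ +-identityʳ _ ⟩
    t₁ + - t₁                    ≈⟨ -‿inverseʳ t₁ ⟩
    0#                           ∎
    where
    t₀ = M zero zero * det (suc n) (minor zero M)
    t₁ = M zero (suc zero) * det (suc n) (minor (suc zero) M)
    rest = alt (λ k → M zero (suc (suc k)) * det (suc n) (minor (suc (suc k)) M))
    minors : ∀ a b → minor zero M a b ≈ minor (suc zero) M a b
    minors a zero    = sym (cols (suc a))
    minors a (suc b) = refl
    rest≈0 : rest ≈ 0#
    rest≈0 = alt-zero _ λ k →
      trans (*-congˡ {M zero (suc (suc k))} (minor-equalCols01 n M cols k)) (zeroʳ _)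

  minor-equalCols01 (suc n) M cols k = det-equalCols01 n (minor (suc (suc k)) M) (λ a → cols (suc a))

  swap01 : ∀ {n} → Fin (suc (suc n)) → Fin (suc (suc n))
  swap01 zero          = suc zero
  swap01 (suc zero)    = zero
  swap01 (suc (suc k)) = suc (suc k)

  -[x-y+z]≈y-x-z : ∀ x y z → - ((x + - y) + z) ≈ (y + - x) + - z
  -[x-y+z]≈y-x-z x y z = begin
    - ((x + - y) + z) ≈⟨ -‿distrib-+ _ z ⟩
    - (x + - y) + - z ≈⟨ +-congʳ (-‿distrib-+- x y) ⟩
    (- x + y) + - z   ≈⟨ +-congʳ (+-comm (- x) y) ⟩
    (y + - x) + - z   ∎

  det-swapCols01 : ∀ n (M : Mat (suc (suc n))) →
    det (suc (suc n)) (λ i j → M i (swap01 j)) ≈ - det (suc (suc n)) M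
  minor-swapCols01 : ∀ n (M : Mat (suc (suc n))) (k : Fin n) →
    det (suc n) (minor (suc (suc k)) (λ i j → M i (swap01 j))) ≈ - det (suc n) (minor (suc (suc k)) M)

  det-swapCols01 n M = begin
    det (suc (suc n)) M′                       ≈⟨ alt-suc-suc (λ j → M′ zero j * det (suc n) (minor j M′)) ⟩
    (t₀′ + - t₁′) + alt (λ k → M zero (suc (suc k)) * det (suc n) (minor (suc (suc k)) M′))
      ≈⟨ +-cong (+-cong (*-congˡ {M zero (suc zero)} (det-cong (suc n) minor₀))
                        (-‿cong (*-congˡ {M zero zero} (det-cong (suc n) minor₁))))
                (alt-cong λ k → *-congˡ {M zero (suc (suc k))} (minor-swapCols01 n M k)) ⟩
    (t₁ + - t₀) + alt (λ k → M zero (suc (suc k)) * - det (suc n) (minor (suc (suc k)) M))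
      ≈⟨ +-congˡ (alt-cong λ k → -‿distribʳ-* (M zero (suc (suc k))) _) ⟨
    (t₁ + - t₀) + alt (λ k → - (M zero (suc (suc k)) * det (suc n) (minor (suc (suc k)) M)))
      ≈⟨ +-congˡ (alt-neg (λ k → M zero (suc (suc k)) * det (suc n) (minor (suc (suc k)) M))) ⟩
    (t₁ + - t₀) + - rest                       ≈⟨ -[x-y+z]≈y-x-z t₀ t₁ rest ⟨
    - ((t₀ + - t₁) + rest)                     ≈⟨ -‿cong (alt-suc-suc (λ j → M zero j * det (suc n) (minor j M))) ⟨
    - det (suc (suc n)) M                      ∎
    where
    M′ : Mat (suc (suc n))
    M′ i j = M i (swap01 j)
    t₀′ = M′ zero zero * det (suc n) (minor zero M′)
    t₁′ = M′ zero (suc zero) * det (suc n) (minor (suc zero) M′)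
    t₀ = M zero zero * det (suc n) (minor zero M)
    t₁ = M zero (suc zero) * det (suc n) (minor (suc zero) M)
    rest = alt (λ k → M zero (suc (suc k)) * det (suc n) (minor (suc (suc k)) M))
    minor₀ : ∀ a b → minor zero M′ a b ≈ minor (suc zero) M a b
    minor₀ a zero    = refl
    minor₀ a (suc b) = refl
    minor₁ : ∀ a b → minor (suc zero) M′ a b ≈ minor zero M a b
    minor₁ a zero    = refl
    minor₁ a (suc b) = refl

  minor-swapCols01 (suc n) M k =
    trans (det-cong (suc (suc n)) swap-commutes) (det-swapCols01 n (minor (suc (suc k)) M))
    where
    swap-commutes : ∀ a b → minor (suc (suc k)) (λ i j → M i (swap01 j)) a b ≈ minor (suc (suc k)) M a (swap01 b)
    swap-commutes a zero          = refl
    swap-commutes a (suc zero)    = refl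
    swap-commutes a (suc (suc b)) = refl

  det-swapRows01 : ∀ n (M : Mat (suc (suc n))) → det (suc (suc n)) (λ i → M (swap01 i)) ≈ - det (suc (suc n)) M
  det-swapRows01 n M = begin
    det (suc (suc n)) (λ i → M (swap01 i))             ≈⟨ det-transpose (suc (suc n)) (λ i → M (swap01 i)) ⟨
    det (suc (suc n)) (λ i j → transpose M i (swap01 j)) ≈⟨ det-swapCols01 n (transpose M) ⟩
    - det (suc (suc n)) (transpose M)                  ≈⟨ -‿cong (det-transpose (suc (suc n)) M) ⟩
    - det (suc (suc n)) M                              ∎

  det-equalRows : ∀ n (M : Mat (suc n)) (i : Fin n) → (∀ j → M zero j ≈ M (suc i) j) → det (suc n) M ≈ 0#
  det-equalRows (suc n) M zero    rows =
    trans (det-transpose (suc (suc n)) (transpose M)) (det-equalCols01 n (transpose M) rows)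
  det-equalRows (suc n) M (suc i) rows = begin
    det (suc (suc n)) M       ≈⟨ ⁻¹-involutive _ ⟨
    - - det (suc (suc n)) M   ≈⟨ -‿cong (det-swapRows01 n M) ⟨
    - det (suc (suc n)) N     ≈⟨ -‿cong (alt-zero _ λ j → trans (*-congˡ {N zero j} (minor≈0 j)) (zeroʳ _)) ⟩
    - 0#                      ≈⟨ ε⁻¹≈ε ⟩
    0#                        ∎
    where
    N : Mat (suc (suc n))
    N k = M (swap01 k)
    minor≈0 : ∀ j → det (suc n) (minor j N) ≈ 0#
    minor≈0 j = det-equalRows n (minor j N) i (λ b → rows (punchIn j b))

  replaceRow : ∀ {m n} → Fin n → (Fin m → Carrier) → (Fin n → Fin m → Carrier) → Fin n → Fin m → Carrier
  replaceRow i w M = updateAt M i (λ _ → w)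

  replaceRow-∘ʳ : ∀ {m m′ n} (g : Fin m′ → Fin m) (i : Fin n) w (M : Fin n → Fin m → Carrier) a b →
    replaceRow i (λ b → w (g b)) (λ a b → M a (g b)) a b ≡ replaceRow i w M a (g b)
  replaceRow-∘ʳ g zero    w M zero    b = ≡-refl
  replaceRow-∘ʳ g zero    w M (suc a) b = ≡-refl
  replaceRow-∘ʳ g (suc i) w M zero    b = ≡-refl
  replaceRow-∘ʳ g (suc i) w M (suc a) b = replaceRow-∘ʳ g i w (λ a → M (suc a)) a b

  alt-*-sum : ∀ {m n} (x : Fin n → Carrier) (g : Fin m → Carrier) (E : Fin m → Fin n → Carrier) →
    alt (λ j → x j * sum (λ i → g i * E i j)) ≈ sum (λ i → g i * alt (λ j → x j * E i j))
  alt-*-sum x g E = begin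
    alt (λ j → x j * sum (λ i → g i * E i j))
      ≈⟨ alt-cong (λ j → *-distribˡ-sum (x j) (λ i → g i * E i j)) ⟩
    alt (λ j → sum (λ i → x j * (g i * E i j)))
      ≈⟨ alt-sum-comm (λ i j → x j * (g i * E i j)) ⟩
    sum (λ i → alt (λ j → x j * (g i * E i j)))
      ≈⟨ sum-cong-≋ (λ i → alt-cong (λ j → x∙yz≈y∙xz (x j) (g i) (E i j))) ⟩
    sum (λ i → alt (λ j → g i * (x j * E i j)))
      ≈⟨ sum-cong-≋ (λ i → *-distribˡ-alt (g i) (λ j → x j * E i j)) ⟨
    sum (λ i → g i * alt (λ j → x j * E i j)) ∎

  sum-zero : ∀ {n} (f : Fin n → Carrier) → (∀ i → f i ≈ 0#) → sum f ≈ 0#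
  sum-zero {n} f f≈0 = trans (sum-cong-≋ f≈0) (sum-replicate-zero n)

  [x+c*y]*[u+v] : ∀ x c y u v → (x + c * y) * (u + v) ≈ (x * u + x * v) + c * (y * u + y * v)
  [x+c*y]*[u+v] x c y u v = trans (expand x (c * y) u v)
    (+-congˡ (trans (+-cong (*-assoc c y u) (*-assoc c y v)) (sym (distribˡ c (y * u) (y * v)))))
    where
    expand : ∀ x y u v → (x + y) * (u + v) ≈ (x * u + x * v) + (y * u + y * v)
    expand = solve 4 (λ x y u v →
      ((x ⊕ y) ⊗ (u ⊕ v)) ⊜ (((x ⊗ u) ⊕ (x ⊗ v)) ⊕ ((y ⊗ u) ⊕ (y ⊗ v)))) refl

  det-+-rankOne : ∀ n (M : Mat n) (c w : Fin n → Carrier) →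
    det n (λ i j → M i j + c i * w j) ≈ det n M + sum (λ i → c i * det n (replaceRow i w M))
  det-+-rankOne zero    M c w = sym (+-identityʳ 1#)
  det-+-rankOne (suc n) M c w = begin
    alt (λ j → (M zero j + c zero * w j) * det n (minor j N))
      ≈⟨ alt-cong (λ j → *-congˡ {M zero j + c zero * w j} (minor-rankOne j)) ⟩
    alt (λ j → (M zero j + c zero * w j) * (dM j + S j))
      ≈⟨ alt-cong (λ j → [x+c*y]*[u+v] (M zero j) (c zero) (w j) (dM j) (S j)) ⟩
    alt (λ j → (M zero j * dM j + M zero j * S j) + c zero * (w j * dM j + w j * S j))
      ≈⟨ alt-distrib-+ (λ j → M zero j * dM j + M zero j * S j) (λ j → c zero * (w j * dM j + w j * S j)) ⟩
    alt (λ j → M zero j * dM j + M zero j * S j) + alt (λ j → c zero * (w j * dM j + w j * S j))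
      ≈⟨ +-cong (alt-distrib-+ (λ j → M zero j * dM j) (λ j → M zero j * S j))
                (trans (sym (*-distribˡ-alt (c zero) (λ j → w j * dM j + w j * S j)))
                       (*-congˡ {c zero} (alt-distrib-+ (λ j → w j * dM j) (λ j → w j * S j)))) ⟩
    (det (suc n) M + alt (λ j → M zero j * S j)) + c zero * (det (suc n) (replaceRow zero w M) + alt (λ j → w j * S j))
      ≈⟨ +-cong (+-congˡ (alt-*-sum (M zero) (λ i → c (suc i)) E))
                (*-congˡ {c zero} (trans (+-congˡ (trans (alt-*-sum w (λ i → c (suc i)) E) repeated-w))
                                         (+-identityʳ _))) ⟩
    (det (suc n) M + rest) + c zero * det (suc n) (replaceRow zero w M)
      ≈⟨ solve 4 (λ d r c₀ d₀ → ((d ⊕ r) ⊕ (c₀ ⊗ d₀)) ⊜ (d ⊕ ((c₀ ⊗ d₀) ⊕ r))) refl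
           (det (suc n) M) rest (c zero) (det (suc n) (replaceRow zero w M)) ⟩
    det (suc n) M + sum (λ i → c i * det (suc n) (replaceRow i w M)) ∎
    where
    N : Mat (suc n)
    N i j = M i j + c i * w j
    dM : Fin (suc n) → Carrier
    dM j = det n (minor j M)
    E : Fin n → Fin (suc n) → Carrier
    E i j = det n (minor j (replaceRow (suc i) w M))
    S : Fin (suc n) → Carrier
    S j = sum (λ i → c (suc i) * E i j)
    rest = sum (λ i → c (suc i) * det (suc n) (replaceRow (suc i) w M))
    minor-rankOne : ∀ j → det n (minor j N) ≈ dM j + S j
    minor-rankOne j = trans (det-+-rankOne n (minor j M) (λ i → c (suc i)) (λ b → w (punchIn j b)))
      (+-congˡ (sum-cong-≋ λ i → *-congˡ {c (suc i)}
        (det-cong n (λ a b → reflexive (replaceRow-∘ʳ (punchIn j) i w (λ a → M (suc a)) a b)))))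
    repeated-w : sum (λ i → c (suc i) * alt (λ j → w j * E i j)) ≈ 0#
    repeated-w = sum-zero _ λ i → trans (*-congˡ {c (suc i)}
      (det-equalRows n (replaceRow zero w (replaceRow (suc i) w M)) i
        (λ b → sym (reflexive (cong-app (updateAt-updates i (λ a → M (suc a))) b)))))
      (zeroʳ _)

  det-addRow0 : ∀ n (M : Mat (suc n)) (c : Fin n → Carrier) →
    det (suc n) (λ i j → M i j + (0# ∷ c) i * M zero j) ≈ det (suc n) M
  det-addRow0 n M c = begin
    det (suc n) (λ i j → M i j + (0# ∷ c) i * M zero j)
      ≈⟨ det-+-rankOne (suc n) M (0# ∷ c) (M zero) ⟩
    det (suc n) M + (0# * det (suc n) (replaceRow zero (M zero) M)
                     + sum (λ i → c i * det (suc n) (replaceRow (suc i) (M zero) M)))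
      ≈⟨ +-congˡ (+-cong (zeroˡ _) (sum-zero _ λ i → trans (*-congˡ {c i} (repeated-row i)) (zeroʳ (c i)))) ⟩
    det (suc n) M + (0# + 0#)  ≈⟨ +-congˡ (+-identityʳ 0#) ⟩
    det (suc n) M + 0#         ≈⟨ +-identityʳ _ ⟩
    det (suc n) M              ∎
    where
    repeated-row : ∀ i → det (suc n) (replaceRow (suc i) (M zero) M) ≈ 0#
    repeated-row i = det-equalRows n (replaceRow (suc i) (M zero) M) i
      (λ b → sym (reflexive (cong-app (updateAt-updates i (λ a → M (suc a))) b)))

  det-addCol0 : ∀ n (M : Mat (suc n)) (c : Fin n → Carrier) →
    det (suc n) (λ i j → M i j + (0# ∷ c) j * M i zero) ≈ det (suc n) M
  det-addCol0 n M c = begin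
    det (suc n) (λ i j → M i j + (0# ∷ c) j * M i zero)
      ≈⟨ det-transpose (suc n) (λ i j → M i j + (0# ∷ c) j * M i zero) ⟨
    det (suc n) (λ i j → M j i + (0# ∷ c) i * M j zero) ≈⟨ det-addRow0 n (transpose M) c ⟩
    det (suc n) (transpose M)                          ≈⟨ det-transpose (suc n) M ⟩
    det (suc n) M                                      ∎

record Filtration {c ℓ} (R : CommutativeRing c ℓ) : Set (c ⊔ ℓ ⊔ lsuc 0ℓ) where
  open CommutativeRing R
  field
    F        : ℕ → Carrier → Set
    F-resp   : ∀ {k x y} → x ≈ y → F k x → F k y
    F-0#     : ∀ {k} → F k 0#
    F-+      : ∀ {k x y} → F k x → F k y → F k (x + y)
    F-neg    : ∀ {k x} → F k x → F k (- x)
    F-*      : ∀ {a b x y} → F a x → F b y → F (a ℕ.+ b) (x * y)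
    F-whole  : ∀ x → F 0 x
    F-two    : F 1 (1# + 1#)

double : ℕ → ℕ
double zero    = zero
double (suc t) = suc (suc (double t))

module DeterminantFiltration {c ℓ} {R : CommutativeRing c ℓ} (𝔽 : Filtration R) where

  open import Data.Fin using (Fin; zero; suc; punchIn)
  open import Data.Maybe using (nothing)
  open import Data.Vec.Functional using (_∷_)
  open CommutativeRing R hiding (zero)
  open Filtration 𝔽
  open Determinant R
  open import Algebra.Properties.Ring ring using (-1*x≈-x)
  open import Relation.Binary.Reasoning.Setoid setoid
  import Tactic.RingSolver.Core.AlmostCommutativeRing as ACR
  open import Tactic.RingSolver.NonReflective (ACR.fromCommutativeRing R (λ _ → nothing))
    using (solve; _⊜_; _⊕_)

  F-double : ∀ {k x} → F k x → F (suc k) (x + x)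
  F-double {k} {x} x∈F = F-resp two*x≈x+x (F-* F-two x∈F)
    where
    two*x≈x+x : (1# + 1#) * x ≈ x + x
    two*x≈x+x = trans (distribʳ x 1# 1#) (+-cong (*-identityˡ x) (*-identityˡ x))

  F-alt : ∀ {n k} (f : Fin n → Carrier) → (∀ j → F k (f j)) → F k (alt f)
  F-alt {zero}  f f∈F = F-0#
  F-alt {suc n} f f∈F = F-+ (f∈F zero) (F-neg (F-alt (λ j → f (suc j)) (λ j → f∈F (suc j))))

  det-∈F : ∀ n (M : Mat n) → (∀ i j → F 1 (M i j)) → F n (det n M)
  det-∈F zero    M M∈F = F-whole 1#
  det-∈F (suc n) M M∈F = F-alt _ λ j →
    F-* (M∈F zero j) (det-∈F n (minor j M) (λ a b → M∈F (suc a) (punchIn j b)))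

  alt-alt-∈F : ∀ {m k} (f : Fin m → Fin m → Carrier) →
    (∀ i → F k (f i i)) → (∀ i j → F k (f i j + f j i)) → F k (alt (λ j → alt (λ i → f i j)))
  alt-alt-∈F {zero}  f diag pairs = F-0#
  alt-alt-∈F {suc m} f diag pairs = F-resp (sym regroup)
    (F-+ (diag zero) (F-+ (F-neg (F-resp (alt-distrib-+ A-terms A′-terms) (F-alt _ (λ i → pairs (suc i) zero))))
      (alt-alt-∈F (λ i j → f (suc i) (suc j)) (λ i → diag (suc i)) (λ i j → pairs (suc i) (suc j)))))
    where
    A-terms A′-terms : Fin m → Carrier
    A-terms  i = f (suc i) zero
    A′-terms j = f zero (suc j)
    A  = alt A-terms
    A′ = alt A′-terms
    Z  = alt (λ j → alt (λ i → f (suc i) (suc j)))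
    regroup : alt (λ j → alt (λ i → f i j)) ≈ f zero zero + (- (A + A′) + Z)
    regroup = begin
      (f zero zero + - A) + - alt (λ j → f zero (suc j) + - alt (λ i → f (suc i) (suc j)))
        ≈⟨ +-congˡ (-‿cong (trans (alt-distrib-+ A′-terms (λ j → - alt (λ i → f (suc i) (suc j))))
                                  (+-congˡ (alt-neg (λ j → alt (λ i → f (suc i) (suc j))))))) ⟩
      (f zero zero + - A) + - (A′ + - Z)   ≈⟨ +-congˡ (-‿distrib-+- A′ Z) ⟩
      (f zero zero + - A) + (- A′ + Z)
        ≈⟨ solve 4 (λ a b c d → ((a ⊕ b) ⊕ (c ⊕ d)) ⊜ (a ⊕ ((b ⊕ c) ⊕ d))) refl (f zero zero) (- A) (- A′) Z ⟩
      f zero zero + ((- A + - A′) + Z)     ≈⟨ +-congˡ (+-congʳ (-‿distrib-+ A A′)) ⟨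
      f zero zero + (- (A + A′) + Z)       ∎

  oddSymmetric-det-∈F : ∀ t (C : Mat (suc (double t))) → (∀ i j → C i j ≈ C j i) →
    (∀ i j → F 1 (C i j)) → (∀ i → F 2 (C i i)) → F (suc (suc (double t))) (det (suc (double t)) C)
  oddSymmetric-det-∈F zero    C C-sym C∈F₁ diag∈F₂ = F-+ (F-* (diag∈F₂ zero) (F-whole 1#)) (F-neg F-0#)
  oddSymmetric-det-∈F (suc t) C C-sym C∈F₁ diag∈F₂ =
    F-+ first-term (F-neg (F-resp (sym other-terms) (alt-alt-∈F f f-diag f-pairs)))
    where
    p = suc (double t)
    D : Fin (suc p) → Fin (suc p) → Carrier
    D i j = det p (λ a b → C (suc (punchIn i a)) (suc (punchIn j b)))
    f : Fin (suc p) → Fin (suc p) → Carrier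
    f i j = C zero (suc j) * (C (suc i) zero * D i j)
    first-term : F (suc (suc (suc p))) (C zero zero * det (suc p) (minor zero C))
    first-term = F-* (diag∈F₂ zero) (det-∈F (suc p) (minor zero C) (λ a b → C∈F₁ (suc a) (suc b)))
    other-terms : alt (λ j → C zero (suc j) * det (suc p) (minor (suc j) C)) ≈ alt (λ j → alt (λ i → f i j))
    other-terms = alt-cong λ j →
      trans (*-congˡ {C zero (suc j)} (det-expandCol0 p (minor (suc j) C)))
            (*-distribˡ-alt (C zero (suc j)) (λ i → C (suc i) zero * D i j))
    D-sym : ∀ i j → D j i ≈ D i j
    D-sym i j = trans (det-cong p (λ a b → C-sym (suc (punchIn j a)) (suc (punchIn i b))))
                      (det-transpose p (λ a b → C (suc (punchIn i a)) (suc (punchIn j b))))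
    f-sym : ∀ i j → f j i ≈ f i j
    f-sym i j = begin
      C zero (suc i) * (C (suc j) zero * D j i)
        ≈⟨ *-cong (C-sym zero (suc i)) (*-cong (C-sym (suc j) zero) (D-sym i j)) ⟩
      C (suc i) zero * (C zero (suc j) * D i j)
        ≈⟨ x∙yz≈y∙xz _ _ _ ⟩
      f i j ∎
    f-diag : ∀ i → F (suc (suc (suc p))) (f i i)
    f-diag i = F-* (C∈F₁ zero (suc i)) (F-* (C∈F₁ (suc i) zero)
      (oddSymmetric-det-∈F t (λ a b → C (suc (punchIn i a)) (suc (punchIn i b)))
        (λ a b → C-sym (suc (punchIn i a)) (suc (punchIn i b)))
        (λ a b → C∈F₁ (suc (punchIn i a)) (suc (punchIn i b)))
        (λ a → diag∈F₂ (suc (punchIn i a)))))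
    f-pairs : ∀ i j → F (suc (suc (suc p))) (f i j + f j i)
    f-pairs i j = F-resp (+-congˡ (sym (f-sym i j))) (F-double
      (F-* (C∈F₁ zero (suc j)) (F-* (C∈F₁ (suc i) zero)
        (det-∈F p _ (λ a b → C∈F₁ (suc (punchIn i a)) (suc (punchIn j b)))))))

  centre : ∀ {n} → Mat (suc n) → Mat n
  centre E i j = (E (suc i) (suc j) + - E zero (suc j)) + - (E (suc i) zero + - E zero zero)

  centre-expand : ∀ {n} (E : Mat (suc n)) i j →
    centre E i j ≈ E (suc i) (suc j) + (- E zero (suc j) + (- E (suc i) zero + E zero zero))
  centre-expand E i j = trans (+-congˡ (-‿distrib-+- _ _)) (+-assoc _ _ _)

  centre-sym : ∀ {n} (E : Mat (suc n)) → (∀ i j → E i j ≈ E j i) → ∀ i j → centre E i j ≈ centre E j i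
  centre-sym E E-sym i j = begin
    centre E i j
      ≈⟨ centre-expand E i j ⟩
    E (suc i) (suc j) + (- E zero (suc j) + (- E (suc i) zero + E zero zero))
      ≈⟨ solve 4 (λ a b c d → (a ⊕ (b ⊕ (c ⊕ d))) ⊜ (a ⊕ (c ⊕ (b ⊕ d)))) refl _ _ _ _ ⟩
    E (suc i) (suc j) + (- E (suc i) zero + (- E zero (suc j) + E zero zero))
      ≈⟨ +-cong (E-sym _ _) (+-cong (-‿cong (E-sym _ _)) (+-congʳ (-‿cong (E-sym _ _)))) ⟩
    E (suc j) (suc i) + (- E zero (suc i) + (- E (suc j) zero + E zero zero))
      ≈⟨ centre-expand E j i ⟨
    centre E j i ∎

  centre-diag : ∀ {n} (E : Mat (suc n)) → (∀ i j → E i j ≈ E j i) → (∀ i j → E i i ≈ E j j) →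
    ∀ i → centre E i i ≈ (E zero zero + - E (suc i) zero) + (E zero zero + - E (suc i) zero)
  centre-diag E E-sym E-diag i = begin
    centre E i i
      ≈⟨ centre-expand E i i ⟩
    E (suc i) (suc i) + (- E zero (suc i) + (- E (suc i) zero + E zero zero))
      ≈⟨ +-cong (E-diag _ _) (+-congʳ (-‿cong (E-sym _ _))) ⟩
    E zero zero + (- E (suc i) zero + (- E (suc i) zero + E zero zero))
      ≈⟨ solve 4 (λ a b c d → (a ⊕ (b ⊕ (c ⊕ d))) ⊜ ((a ⊕ b) ⊕ (d ⊕ c))) refl _ _ _ _ ⟩
    (E zero zero + - E (suc i) zero) + (E zero zero + - E (suc i) zero) ∎

  [x-1]-[y-1] : ∀ x y → (x + - 1#) + - 1# * (y + - 1#) ≈ x + - y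
  [x-1]-[y-1] x y = begin
    (x + - 1#) + - 1# * (y + - 1#) ≈⟨ +-congˡ (trans (-1*x≈-x _) (-‿distrib-+- y 1#)) ⟩
    (x + - 1#) + (- y + 1#)
      ≈⟨ solve 4 (λ x n y o → ((x ⊕ n) ⊕ (y ⊕ o)) ⊜ ((x ⊕ y) ⊕ (n ⊕ o))) refl x (- 1#) (- y) 1# ⟩
    (x + - y) + (- 1# + 1#)        ≈⟨ +-congˡ (-‿inverseˡ 1#) ⟩
    (x + - y) + 0#                 ≈⟨ +-identityʳ _ ⟩
    x + - y                        ∎

  x+0*y≈x : ∀ x y → x + 0# * y ≈ x
  x+0*y≈x x y = trans (+-congˡ (zeroˡ y)) (+-identityʳ x)

  evenOrder-det-∈F : ∀ t (E : Mat (double t)) → (∀ i j → F 1 (E i j)) → (∀ i j → E i j ≈ E j i) →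
    (∀ i j → E i i ≈ E j j) → F (double t) (det (double t) (λ i j → E i j + - 1#))
  evenOrder-det-∈F zero    E E∈F₁ E-sym E-diag = F-whole 1#
  evenOrder-det-∈F (suc t) E E∈F₁ E-sym E-diag =
    F-resp (trans (det-addCol0 k M₁ minusOne) (det-addRow0 k M minusOne))
      (F-+ corner-term (F-neg (F-alt _ border-term)))
    where
    k = suc (double t)
    minusOne : Fin k → Carrier
    minusOne _ = - 1#
    -- M₂ is E − J after subtracting row 0 from the other rows and then column 0 from the other columns.
    M M₁ M₂ : Mat (suc k)
    M  i j = E i j + - 1#
    M₁ i j = M i j + (0# ∷ minusOne) i * M zero j
    M₂ i j = M₁ i j + (0# ∷ minusOne) j * M₁ i zero
    difference-∈F₁ : ∀ a b a′ b′ → F 1 (E a b + - E a′ b′)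
    difference-∈F₁ a b a′ b′ = F-+ (E∈F₁ a b) (F-neg (E∈F₁ a′ b′))
    centre-∈F₁ : ∀ i j → F 1 (centre E i j)
    centre-∈F₁ i j = F-+ (difference-∈F₁ _ _ _ _) (F-neg (difference-∈F₁ _ _ _ _))
    centre-diag-∈F₂ : ∀ i → F 2 (centre E i i)
    centre-diag-∈F₂ i = F-resp (sym (centre-diag E E-sym E-diag i))
      (F-double (difference-∈F₁ _ _ _ _))
    M₁-lower : ∀ i j → M₁ (suc i) j ≈ E (suc i) j + - E zero j
    M₁-lower i j = [x-1]-[y-1] _ _
    M₂-centre : ∀ i j → M₂ (suc i) (suc j) ≈ centre E i j
    M₂-centre i j = +-cong (M₁-lower i (suc j)) (trans (-1*x≈-x _) (-‿cong (M₁-lower i zero)))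
    M₂-top : ∀ j → M₂ zero (suc j) ≈ E zero (suc j) + - E zero zero
    M₂-top j = trans (+-cong (x+0*y≈x _ _) (*-congˡ { - 1#} (x+0*y≈x _ _))) ([x-1]-[y-1] _ _)
    M₂-lower : ∀ i j → F 1 (M₂ (suc i) j)
    M₂-lower i zero    = F-resp (sym (trans (x+0*y≈x _ _) (M₁-lower i zero))) (difference-∈F₁ _ _ _ _)
    M₂-lower i (suc j) = F-resp (sym (M₂-centre i j)) (centre-∈F₁ i j)
    corner-term : F (suc k) (M₂ zero zero * det k (minor zero M₂))
    corner-term = F-* (F-whole _) (F-resp (det-cong k (λ a b → sym (M₂-centre a b)))
      (oddSymmetric-det-∈F t (centre E) (centre-sym E E-sym) centre-∈F₁ centre-diag-∈F₂))
    border-term : ∀ j → F (suc k) (M₂ zero (suc j) * det k (minor (suc j) M₂))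
    border-term j = F-* (F-resp (sym (M₂-top j)) (difference-∈F₁ _ _ _ _))
      (det-∈F k (minor (suc j) M₂) (λ a b → M₂-lower a (punchIn (suc j) b)))

module PowersOf𝔪 where

  open Polynomial
  open import Data.Integer using (+_; 0ℤ; 1ℤ; _*_)
  import Data.Integer.Properties as ℤ
  open import Data.Integer.Divisibility.Signed
    using (_∣_; divides; ∣-refl; ∣-trans; ∣-reflexive; ∣m∣n⇒∣m+n; ∣m⇒∣-m; *-monoˡ-∣; *-monoʳ-∣)
  open import Data.List using ([]; _∷_)
  open import Data.Nat using (_∸_; _^_; _≤_) renaming (_+_ to _+ℕ_; _*_ to _*ℕ_)
  import Data.Nat.Properties as ℕₚ
  open import Algebra.Properties.CommutativeSemigroup ℕₚ.+-commutativeSemigroup using (x∙yz≈y∙xz)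
  open import Relation.Binary.PropositionalEquality using (_≡_; sym; trans; cong; subst; module ≡-Reasoning)

  -- 𝔪^k is generated by the monomials 2^(k ∸ i) x^i; for i ≥ k the truncated exponent is 0.
  infix 4 _∈𝔪^_
  _∈𝔪^_ : Poly → ℕ → Set
  p ∈𝔪^ k = ∀ i → + (2 ^ (k ∸ i)) ∣ coeff p i

  2^-mono-∣ : ∀ {m n} → m ≤ n → + (2 ^ m) ∣ + (2 ^ n)
  2^-mono-∣ {m} {n} m≤n = divides (+ (2 ^ (n ∸ m))) (begin
    + (2 ^ n)                    ≡⟨ cong (λ e → + (2 ^ e)) (sym (ℕₚ.m+[n∸m]≡n m≤n)) ⟩
    + (2 ^ (m +ℕ (n ∸ m)))       ≡⟨ cong +_ (ℕₚ.^-distribˡ-+-* 2 m (n ∸ m)) ⟩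
    + (2 ^ m *ℕ 2 ^ (n ∸ m))     ≡⟨ cong +_ (ℕₚ.*-comm (2 ^ m) _) ⟩
    + (2 ^ (n ∸ m) *ℕ 2 ^ m)     ≡⟨ ℤ.pos-* (2 ^ (n ∸ m)) (2 ^ m) ⟩
    + (2 ^ (n ∸ m)) * + (2 ^ m)  ∎)
    where open ≡-Reasoning

  2^-*-∣ : ∀ {a b x y} → + (2 ^ a) ∣ x → + (2 ^ b) ∣ y → + (2 ^ (a +ℕ b)) ∣ x * y
  2^-*-∣ {a} {b} {x} 2^a∣x 2^b∣y =
    ∣-trans (∣-reflexive 2^[a+b]≡2^a*2^b) (∣-trans (*-monoˡ-∣ (+ (2 ^ b)) 2^a∣x) (*-monoʳ-∣ x 2^b∣y))
    where
    2^[a+b]≡2^a*2^b : + (2 ^ (a +ℕ b)) ≡ + (2 ^ a) * + (2 ^ b)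
    2^[a+b]≡2^a*2^b = trans (cong +_ (ℕₚ.^-distribˡ-+-* 2 a b)) (ℤ.pos-* (2 ^ a) (2 ^ b))

  [a+b]∸i≤a+[b∸i] : ∀ a b i → (a +ℕ b) ∸ i ≤ a +ℕ (b ∸ i)
  [a+b]∸i≤a+[b∸i] a b i = ℕₚ.m≤n+o⇒m∸n≤o (a +ℕ b) i
    (ℕₚ.≤-trans (ℕₚ.+-monoʳ-≤ a (ℕₚ.m≤n+m∸n b i)) (ℕₚ.≤-reflexive (x∙yz≈y∙xz a i (b ∸ i))))

  ∈𝔪^-resp : ∀ {k p q} → p ≈P q → p ∈𝔪^ k → q ∈𝔪^ k
  ∈𝔪^-resp {k} p≈q p∈ i = subst (λ z → + (2 ^ (k ∸ i)) ∣ z) (coeff-≡ p≈q i) (p∈ i)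

  []∈𝔪^ : ∀ {k} → [] ∈𝔪^ k
  []∈𝔪^ {k} i = divides 0ℤ (sym (ℤ.*-zeroˡ (+ (2 ^ (k ∸ i)))))

  +P-∈𝔪^ : ∀ {k p q} → p ∈𝔪^ k → q ∈𝔪^ k → p +P q ∈𝔪^ k
  +P-∈𝔪^ {k} {p} {q} p∈ q∈ i =
    subst (λ z → + (2 ^ (k ∸ i)) ∣ z) (sym (coeff-+P p q i)) (∣m∣n⇒∣m+n (p∈ i) (q∈ i))

  negP-∈𝔪^ : ∀ {k p} → p ∈𝔪^ k → negP p ∈𝔪^ k
  negP-∈𝔪^ {k} {p} p∈ i = subst (λ z → + (2 ^ (k ∸ i)) ∣ z) (sym (coeff-negP p i)) (∣m⇒∣-m (p∈ i))

  ∈𝔪^0 : ∀ p → p ∈𝔪^ 0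
  ∈𝔪^0 p i rewrite ℕₚ.0∸n≡0 i = divides (coeff p i) (sym (ℤ.*-identityʳ (coeff p i)))

  evenConstant-∈𝔪 : ∀ {p} → + 2 ∣ coeff p 0 → p ∈𝔪^ 1
  evenConstant-∈𝔪     2∣p₀ zero    = 2∣p₀
  evenConstant-∈𝔪 {p} 2∣p₀ (suc i) rewrite ℕₚ.0∸n≡0 i = ∈𝔪^0 p (suc i)

  *P-∈𝔪^ : ∀ {a b p q} → p ∈𝔪^ a → q ∈𝔪^ b → p *P q ∈𝔪^ (a +ℕ b)
  *P-∈𝔪^ {a} {b} {[]}    {q} p∈ q∈ = []∈𝔪^
  *P-∈𝔪^ {a} {b} {c ∷ p} {q} p∈ q∈ = +P-∈𝔪^ {a +ℕ b} {scaleP c q} scaled shifted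
    where
    scaled : scaleP c q ∈𝔪^ (a +ℕ b)
    scaled i = subst (λ z → + (2 ^ ((a +ℕ b) ∸ i)) ∣ z) (sym (coeff-scaleP c q i))
      (∣-trans (2^-mono-∣ ([a+b]∸i≤a+[b∸i] a b i)) (2^-*-∣ {a} {b ∸ i} (p∈ zero) (q∈ i)))
    tail∈ : p ∈𝔪^ (a ∸ 1)
    tail∈ i = subst (λ e → + (2 ^ e) ∣ coeff p i) (sym (ℕₚ.∸-+-assoc a 1 i)) (p∈ (suc i))
    exponent-≤ : ∀ a i → (a +ℕ b) ∸ suc i ≤ ((a ∸ 1) +ℕ b) ∸ i
    exponent-≤ zero    i = ℕₚ.∸-monoʳ-≤ b (ℕₚ.n≤1+n i)
    exponent-≤ (suc a) i = ℕₚ.≤-refl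
    shifted : 0ℤ ∷ p *P q ∈𝔪^ (a +ℕ b)
    shifted zero    = []∈𝔪^ {a +ℕ b} 0
    shifted (suc i) = ∣-trans (2^-mono-∣ (exponent-≤ a i)) (*P-∈𝔪^ {a ∸ 1} {b} {p} tail∈ q∈ i)

  𝔪-adic : Filtration ℤ[X]
  𝔪-adic = record
    { F       = λ k p → p ∈𝔪^ k
    ; F-resp  = λ {k} → ∈𝔪^-resp {k}
    ; F-0#    = []∈𝔪^
    ; F-+     = λ {k} {p} {q} → +P-∈𝔪^ {k} {p} {q}
    ; F-neg   = λ {k} {p} → negP-∈𝔪^ {k} {p}
    ; F-*     = λ {a} {b} {p} {q} → *P-∈𝔪^ {a} {b} {p} {q}
    ; F-whole = ∈𝔪^0
    ; F-two   = evenConstant-∈𝔪 {constP 1ℤ +P constP 1ℤ} ∣-refl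
    }

open import Data.Bool using (true; false; if_then_else_)
open import Data.Fin using (Fin; zero; suc; punchIn; _≟_)
open import Data.Integer using (+_; 0ℤ; 1ℤ; -_; _+_; _-_; _*_)
import Data.Integer.Properties as ℤ
open import Data.Integer.Divisibility using (_∣_)
open import Data.Integer.Divisibility.Signed using (divides; ∣⇒∣ᵤ) renaming (_∣_ to _∣ₛ_)
import Data.Integer.Tactic.RingSolver as ℤ-Solver
open import Data.Nat using (_∸_; _^_; _≤_)
open import Data.Nat.Divisibility using () renaming (_∣_ to _∣ℕ_; divides to dividesℕ)
open import Data.Nat.Properties using (m∸[m∸n]≡n)
open import Function using (_∘_)
open import Relation.Nullary using (does; yes; no)
open import Relation.Nullary.Decidable using (dec-true; dec-false)
open import Relation.Binary.PropositionalEquality using (_≡_; refl; sym; cong; cong₂; subst; module ≡-Reasoning)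
open Polynomial
open PowersOf𝔪
open Determinant ℤ[X] using (alt; det; det-cong)
open DeterminantFiltration 𝔪-adic using (evenOrder-det-∈F)

altSum≡alt : ∀ {n} {f g : Fin n → Poly} → (∀ j → f j ≡ g j) → altSum f ≡ alt g
altSum≡alt {zero}  f≡g = refl
altSum≡alt {suc n} f≡g = cong₂ (λ a s → a +P negP s) (f≡g zero) (altSum≡alt (λ j → f≡g (suc j)))

detP≡det : ∀ n M → detP n M ≡ det n M
detP≡det zero    M = refl
detP≡det (suc n) M = altSum≡alt λ j → cong (M zero j *P_) (detP≡det n (λ i k → M (suc i) (punchIn j k)))

≟-does-sym : ∀ {n} (i j : Fin n) → does (i ≟ j) ≡ does (j ≟ i)
≟-does-sym i j with i ≟ j
... | yes refl = sym (dec-true (i ≟ i) refl)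
... | no  i≢j  = sym (dec-false (j ≟ i) (i≢j ∘ sym))

module CharacteristicMatrix {n} (G : SimpleGraph n) where

  xI-[J-2A] : Fin n → Fin n → Poly
  xI-[J-2A] i j = if does (i ≟ j) then X +P constP (- J-2A G i j) else constP (- J-2A G i j)

  xI+2A : Fin n → Fin n → Poly
  xI+2A i j = xI-[J-2A] i j +P constP 1ℤ

  adjMatrix-sym : ∀ i j → adjMatrix G i j ≡ adjMatrix G j i
  adjMatrix-sym i j = cong (λ b → if b then 1ℤ else 0ℤ) (SimpleGraph.sym G i j)

  xI-[J-2A]-sym : ∀ i j → xI-[J-2A] i j ≡ xI-[J-2A] j i
  xI-[J-2A]-sym i j = cong₂ (λ b a → if b then X +P constP (- a) else constP (- a))
    (≟-does-sym i j) (cong (λ a → 1ℤ - + 2 * a) (adjMatrix-sym i j))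

  xI-[J-2A]-diag : ∀ i → xI-[J-2A] i i ≡ X +P constP (- 1ℤ)
  xI-[J-2A]-diag i = cong₂ (λ b a → if b then X +P constP (- a) else constP (- a))
    (dec-true (i ≟ i) refl) (cong (λ b → 1ℤ - + 2 * (if b then 1ℤ else 0ℤ)) (SimpleGraph.loopless G i))

  xI-[J-2A]-constantTerm : ∀ i j → coeff (xI-[J-2A] i j) 0 ≡ - J-2A G i j
  xI-[J-2A]-constantTerm i j with does (i ≟ j)
  ... | true  = ℤ.+-identityˡ _
  ... | false = refl

  -[1-2a]+1≡2a : ∀ a → - (1ℤ - + 2 * a) + 1ℤ ≡ + 2 * a
  -[1-2a]+1≡2a = ℤ-Solver.solve-∀

  xI+2A∈𝔪 : ∀ i j → xI+2A i j ∈𝔪^ 1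
  xI+2A∈𝔪 i j = evenConstant-∈𝔪 {xI+2A i j} (divides (adjMatrix G i j) (begin
    coeff (xI+2A i j) 0           ≡⟨ coeff-+P (xI-[J-2A] i j) (constP 1ℤ) 0 ⟩
    coeff (xI-[J-2A] i j) 0 + 1ℤ  ≡⟨ cong (_+ 1ℤ) (xI-[J-2A]-constantTerm i j) ⟩
    - J-2A G i j + 1ℤ             ≡⟨ -[1-2a]+1≡2a (adjMatrix G i j) ⟩
    + 2 * adjMatrix G i j         ≡⟨ ℤ.*-comm (+ 2) _ ⟩
    adjMatrix G i j * + 2         ∎))
    where open ≡-Reasoning

  xI+2A-sym : ∀ i j → xI+2A i j ≈P xI+2A j i
  xI+2A-sym i j rewrite xI-[J-2A]-sym i j = ≈P-refl

  xI+2A-diag : ∀ i j → xI+2A i i ≈P xI+2A j j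
  xI+2A-diag i j rewrite xI-[J-2A]-diag i | xI-[J-2A]-diag j = ≈P-refl

  xI+2A-1≈xI-[J-2A] : ∀ i j → xI+2A i j +P negP (constP 1ℤ) ≈P xI-[J-2A] i j
  xI+2A-1≈xI-[J-2A] i j = ≈P-trans (+-assoc (xI-[J-2A] i j) (constP 1ℤ) _)
    (≈P-trans (+-congˡ {xI-[J-2A] i j} (-‿inverseʳ (constP 1ℤ))) (+-identityʳ (xI-[J-2A] i j)))
    where open CommutativeRing ℤ[X] using (+-assoc; +-congˡ; -‿inverseʳ; +-identityʳ)

charPoly[J-2A]∈𝔪^n : ∀ t (G : SimpleGraph (double t)) → charPoly (double t) (J-2A G) ∈𝔪^ double t
charPoly[J-2A]∈𝔪^n t G = subst (_∈𝔪^ double t) (sym (detP≡det (double t) xI-[J-2A]))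
  (∈𝔪^-resp (det-cong (double t) xI+2A-1≈xI-[J-2A]) (evenOrder-det-∈F t xI+2A xI+2A∈𝔪 xI+2A-sym xI+2A-diag))
  where open CharacteristicMatrix G

double≡*2 : ∀ q → double q ≡ q ℕ.* 2
double≡*2 zero    = refl
double≡*2 (suc q) = cong (λ m → suc (suc m)) (double≡*2 q)

charPoly[J-2A]∈𝔪^n′ : ∀ q (G : SimpleGraph (q ℕ.* 2)) → charPoly (q ℕ.* 2) (J-2A G) ∈𝔪^ q ℕ.* 2
charPoly[J-2A]∈𝔪^n′ q = subst (λ n → (G : SimpleGraph n) → charPoly n (J-2A G) ∈𝔪^ n)
  (double≡*2 q) (charPoly[J-2A]∈𝔪^n q)

corollary3p2 : (n : ℕ) → 2 ∣ℕ n → (G : SimpleGraph n) →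
    (r : ℕ) → r ≤ n → (+ (2 ^ r)) ∣ coeff (charPoly n (J-2A G)) (n ∸ r)
corollary3p2 n (dividesℕ q refl) G r r≤n =
  ∣⇒∣ᵤ (subst (λ e → + (2 ^ e) ∣ₛ coeff (charPoly n (J-2A G)) (n ∸ r)) (m∸[m∸n]≡n r≤n)
    (charPoly[J-2A]∈𝔪^n′ q G (n ∸ r)))
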